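{- Let $G$ and $H$ be finite simple graphs with at least $4$ edges, let $\{G_i\}_{i\in I}$ and $\{H_i\}_{i\in I}$ be their single-edge-deleted subgraphs, indexed by a common index set $I$, and suppose there are isomorphisms $\gamma_i:G_i\to H_i$ for all $i\in I$. Work in the category $\mathbf{StGrphs}$. Let $\kappa_i:H_i\to H$ be the inclusions and let $\Gamma:\coprod_{i\in I}G_i\to H$ be the morphism induced by the maps $\kappa_i\gamma_i$ via the universal property of the coproduct. Let $p_0,p_1:\coprod_{i\in I}G_i\times\coprod_{i\in I}G_i\to\coprod_{i\in I}G_i$ be the product projections and let $k:R_\Gamma\to \coprod_{i\in I}G_i\times\coprod_{i\in I}G_i$ be the equalizer of $\Gamma p_0$ and $\Gamma p_1$. Then $G$ is edge-reconstructable if and only if there exists an epimorphism $\delta:\coprod_{i\in I}G_i\to G$ in $\mathbf{StGrphs}$ such that $\delta p_0k=\delta p_1k$.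
   Context: Here "$G$ is edge-reconstructable" means, in this setting, that $G$ is isomorphic to $H$. A graph $X$ has vertex set $V(X)$, edge set $E(X)$ and incidence function $\psi_X$ assigning each edge an unordered pair of (not necessarily distinct) vertices; the part set is $P(X)=E(X)\cup V(X)$, and $\psi_X(v)=\{v,v\}$ for vertices. A strict graph morphism $f:X\to Y$ is a function $P(X)\to P(Y)$ mapping vertices to vertices and edges to edges with $\psi_Y(f(e))=\{f(x),f(y)\}$ whenever $\psi_X(e)=\{x,y\}$. $\mathbf{StGrphs}$ is the category of all graphs (multiple edges and loops allowed) with strict graph morphisms. The coproduct is disjoint union. The product $X\times Y$ has vertex set $V(X)\times V(Y)$ and, for edges $e\in E(X)$ with $\psi_X(e)=\{a_1,a_2\}$ and $f\in E(Y)$ with $\psi_Y(f)=\{b_1,b_2\}$, an edge $(e,f)$ with ends $(a_1,b_1),(a_2,b_2)$ and, if $a_1\ne a_2$ and $b_1\ne b_2$, a further edge $\overline{(e,f)}$ with ends $(a_1,b_2),(a_2,b_1)$; the projections send $(u,v)$, $(e,f)$, $\overline{(e,f)}$ to their first (resp. second) coordinate. The equalizer of $f,g:X\to Y$ is the inclusion of the subgraph of $X$ consisting of those parts $a$ with $f(a)=g(a)$ and $f(a_j)=g(a_j)$ for the ends $a_1,a_2$ of $a$. -}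

module Defs where

open import Data.Nat using (ℕ)
open import Data.Fin using (Fin)
open import Data.Bool using (Bool)
open import Data.Product using (Σ; ∃; _×_; _,_; proj₁; proj₂)
open import Data.Sum using (_⊎_; inj₁; inj₂)
open import Function.Bundles using (_↔_; _↣_)
open import Relation.Binary.PropositionalEquality using (_≡_; refl; cong)
open import Relation.Nullary using (¬_)
open import Level using (suc; zero)

-- Graphs (loops and multiple edges allowed).  The unordered pair
-- ψ(e) = {x,y} is represented by an ordered pair `ends e`, with
-- equality of incidences taken up to swapping (UEq).

record Graph : Set₁ where
  field
    V    : Set
    E    : Set
    ends : E → V × V
open Graph public

UEq : {A : Set} → A × A → A × A → Set
UEq (a , b) (c , d) = (a ≡ c × b ≡ d) ⊎ (a ≡ d × b ≡ c)

mapPair : {A B : Set} → (A → B) → A × A → B × B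
mapPair f (a , b) = (f a , f b)

record Hom (X Y : Graph) : Set where
  field
    fV   : V X → V Y
    fE   : E X → E Y
    resp : ∀ e → UEq (ends Y (fE e)) (mapPair fV (ends X e))
open Hom public

_≈H_ : {X Y : Graph} → Hom X Y → Hom X Y → Set
f ≈H g = (∀ v → fV f v ≡ fV g v) × (∀ e → fE f e ≡ fE g e)

idH : {X : Graph} → Hom X X
idH = record { fV = λ v → v ; fE = λ e → e ; resp = λ e → inj₁ (refl , refl) }

private
  resp-∘ : {A B : Set} (f : A → B) {p q : A × A} → UEq p q → UEq (mapPair f p) (mapPair f q)
  resp-∘ f {a , b} {c , d} (inj₁ (refl , refl)) = inj₁ (refl , refl)
  resp-∘ f {a , b} {c , d} (inj₂ (refl , refl)) = inj₂ (refl , refl)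

  ueq-trans : {A : Set} {p q r : A × A} → UEq p q → UEq q r → UEq p r
  ueq-trans {p = a , b} (inj₁ (refl , refl)) y = y
  ueq-trans {p = a , b} (inj₂ (refl , refl)) (inj₁ (refl , refl)) = inj₂ (refl , refl)
  ueq-trans {p = a , b} (inj₂ (refl , refl)) (inj₂ (refl , refl)) = inj₁ (refl , refl)

_∘H_ : {X Y Z : Graph} → Hom Y Z → Hom X Y → Hom X Z
_∘H_ {X} {Y} {Z} g f = record
  { fV = λ v → fV g (fV f v)
  ; fE = λ e → fE g (fE f e)
  ; resp = λ e → ueq-trans (resp g (fE f e)) (resp-∘ (fV g) (resp f e))
  }

Iso : Graph → Graph → Set
Iso X Y = Σ (Hom X Y) λ f → Σ (Hom Y X) λ g → ((g ∘H f) ≈H idH) × ((f ∘H g) ≈H idH)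

Epi : {X Y : Graph} → Hom X Y → Set₁
Epi {X} {Y} δ = (Z : Graph) (g h : Hom Y Z) → (g ∘H δ) ≈H (h ∘H δ) → g ≈H h

IsFinite : Set → Set
IsFinite A = Σ ℕ λ n → A ↔ Fin n

Loopless : Graph → Set
Loopless G = ∀ e → ¬ (proj₁ (ends G e) ≡ proj₂ (ends G e))

NoMultiEdges : Graph → Set
NoMultiEdges G = ∀ e e' → UEq (ends G e) (ends G e') → e ≡ e'

IsFiniteSimple : Graph → Set
IsFiniteSimple G = IsFinite (V G) × IsFinite (E G) × Loopless G × NoMultiEdges G

AtLeast4Edges : Graph → Set
AtLeast4Edges G = Fin 4 ↣ E G

_∖_ : (G : Graph) → E G → Graph
G ∖ e = record { V = V G ; E = Σ (E G) (λ f → ¬ (f ≡ e)) ; ends = λ f → ends G (proj₁ f) }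

incl∖ : (G : Graph) (e : E G) → Hom (G ∖ e) G
incl∖ G e = record { fV = λ v → v ; fE = proj₁ ; resp = λ f → inj₁ (refl , refl) }

∐ : {I : Set} → (I → Graph) → Graph
∐ {I} X = record
  { V = Σ I (λ i → V (X i))
  ; E = Σ I (λ i → E (X i))
  ; ends = λ { (i , e) → mapPair (λ v → (i , v)) (ends (X i) e) } }

copair : {I : Set} {X : I → Graph} {Z : Graph} → ((i : I) → Hom (X i) Z) → Hom (∐ X) Z
copair {I} {X} {Z} f = record
  { fV = λ { (i , v) → fV (f i) v }
  ; fE = λ { (i , e) → fE (f i) e }
  ; resp = λ { (i , e) → lem i e } }
  where
  lem : (i : I) (e : E (X i)) → UEq (ends Z (fE (f i) e)) (mapPair (λ w → fV (f i) w) (ends (X i) e))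
  lem i e with ends (X i) e | resp (f i) e
  ... | (a , b) | r = r

NonLoop : (X : Graph) → E X → Set
NonLoop X e = ¬ (proj₁ (ends X e) ≡ proj₂ (ends X e))

_⊗_ : Graph → Graph → Graph
X ⊗ Y = record
  { V = V X × V Y
  ; E = (E X × E Y) ⊎ Σ (E X × E Y) (λ p → NonLoop X (proj₁ p) × NonLoop Y (proj₂ p))
  ; ends = ends⊗ }
  where
  ends⊗ : (E X × E Y) ⊎ Σ (E X × E Y) (λ p → NonLoop X (proj₁ p) × NonLoop Y (proj₂ p))
        → (V X × V Y) × (V X × V Y)
  ends⊗ (inj₁ (e , f)) =
    ((proj₁ (ends X e) , proj₁ (ends Y f)) , (proj₂ (ends X e) , proj₂ (ends Y f)))
  ends⊗ (inj₂ ((e , f) , _)) =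
    ((proj₁ (ends X e) , proj₂ (ends Y f)) , (proj₂ (ends X e) , proj₁ (ends Y f)))

π₀ : {X Y : Graph} → Hom (X ⊗ Y) X
π₀ {X} {Y} = record { fV = proj₁ ; fE = fE₀ ; resp = r }
  where
  fE₀ : E (X ⊗ Y) → E X
  fE₀ (inj₁ (e , f)) = e
  fE₀ (inj₂ ((e , f) , _)) = e
  r : ∀ e → UEq (ends X (fE₀ e)) (mapPair proj₁ (ends (X ⊗ Y) e))
  r (inj₁ (e , f)) = inj₁ (refl , refl)
  r (inj₂ ((e , f) , _)) = inj₁ (refl , refl)

π₁ : {X Y : Graph} → Hom (X ⊗ Y) Y
π₁ {X} {Y} = record { fV = proj₂ ; fE = fE₁ ; resp = r }
  where
  fE₁ : E (X ⊗ Y) → E Y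
  fE₁ (inj₁ (e , f)) = f
  fE₁ (inj₂ ((e , f) , _)) = f
  r : ∀ e → UEq (ends Y (fE₁ e)) (mapPair proj₂ (ends (X ⊗ Y) e))
  r (inj₁ (e , f)) = inj₁ (refl , refl)
  r (inj₂ ((e , f) , _)) = inj₂ (refl , refl)

EqObj : {X Y : Graph} → Hom X Y → Hom X Y → Graph
EqObj {X} {Y} f g = record
  { V = Σ (V X) (λ v → fV f v ≡ fV g v)
  ; E = Σ (E X) (λ e → (fE f e ≡ fE g e)
                     × (fV f (proj₁ (ends X e)) ≡ fV g (proj₁ (ends X e)))
                     × (fV f (proj₂ (ends X e)) ≡ fV g (proj₂ (ends X e))))
  ; ends = λ { (e , _ , p₁ , p₂) → ((proj₁ (ends X e) , p₁) , (proj₂ (ends X e) , p₂)) } }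

eqIncl : {X Y : Graph} (f g : Hom X Y) → Hom (EqObj f g) X
eqIncl {X} f g = record
  { fV = proj₁ ; fE = proj₁ ; resp = λ { (e , _) → inj₁ (refl , refl) } }

-- Γ is surjective on vertices and edges, because every edge of H survives in
-- some H − h' (H has a second edge) and every Gᵢ is isomorphic to some H − h.
-- If G ≅ H via φ : H → G, then δ = φ ∘ Γ is surjective, hence epi, and it
-- identifies whatever Γ identifies.  Conversely, a δ that coequalizes the
-- kernel pair of the surjection Γ factors as δ = t ∘ Γ; t is epi because δ is,
-- and an epimorphism into a finite simple graph is surjective on vertices and
-- edges.  G and H have equally many vertices (via any γᵢ) and edges (via I),
-- so the surjection t : H → G is an isomorphism.
module Submission where

open import Defs
open import Data.Bool using (Bool; true; false)
open import Data.Fin using (Fin; punchOut) renaming (zero to fzero; suc to fsuc)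
import Data.Fin.Properties as Fin
open import Data.Nat using (zero; suc)
open import Data.Nat.Properties using (1+n≰n)
open import Data.Product using (Σ; _×_; _,_; proj₁; proj₂)
open import Data.Sum using (_⊎_; inj₁; inj₂)
open import Data.Unit using (⊤; tt)
open import Function using (id)
open import Function.Bundles using (_↔_; _↣_; Inverse; Injection; mk↣)
open import Function.Construct.Composition using (_↣-∘_)
open import Function.Definitions using (Injective)
open import Function.Properties.Inverse using (↔⇒↣; ↔-sym)
open import Relation.Binary.Definitions using (DecidableEquality)
open import Relation.Binary.PropositionalEquality
  using (_≡_; _≢_; refl; sym; trans; cong; cong₂; subst)
open import Relation.Nullary using (¬_; Dec; yes; no; contradiction)
open import Relation.Nullary.Decidable using (does; dec-true; dec-false; decidable-stable; via-injection)

private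
  variable
    A B C : Set
    X Y Z : Graph

UEq-sym : {p q : A × A} → UEq p q → UEq q p
UEq-sym {p = a , b} {c , d} (inj₁ (refl , refl)) = inj₁ (refl , refl)
UEq-sym {p = a , b} {c , d} (inj₂ (refl , refl)) = inj₂ (refl , refl)

UEq-trans : {p q r : A × A} → UEq p q → UEq q r → UEq p r
UEq-trans {p = a , b} (inj₁ (refl , refl)) q≈r = q≈r
UEq-trans {p = a , b} (inj₂ (refl , refl)) (inj₁ (refl , refl)) = inj₂ (refl , refl)
UEq-trans {p = a , b} (inj₂ (refl , refl)) (inj₂ (refl , refl)) = inj₁ (refl , refl)

UEq-map : (f : A → B) {p q : A × A} → UEq p q → UEq (mapPair f p) (mapPair f q)
UEq-map f {a , b} {c , d} (inj₁ (refl , refl)) = inj₁ (refl , refl)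
UEq-map f {a , b} {c , d} (inj₂ (refl , refl)) = inj₂ (refl , refl)

mapPair-cong : {f g : A → B} → (∀ x → f x ≡ g x) → ∀ p → mapPair f p ≡ mapPair g p
mapPair-cong f≗g (a , b) = cong₂ _,_ (f≗g a) (f≗g b)

mapPair-agree-on-image : {g : A → B} {h₁ h₂ : B → C} → (∀ x → h₁ (g x) ≡ h₂ (g x)) →
                         ∀ {q p} → UEq q (mapPair g p) → mapPair h₁ q ≡ mapPair h₂ q
mapPair-agree-on-image agree {c , d} {a , b} (inj₁ (refl , refl)) = cong₂ _,_ (agree a) (agree b)
mapPair-agree-on-image agree {c , d} {a , b} (inj₂ (refl , refl)) = cong₂ _,_ (agree b) (agree a)

finite⇒decEq : IsFinite A → DecidableEquality A
finite⇒decEq (n , A↔Fin) = via-injection (↔⇒↣ A↔Fin) Fin._≟_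

finite⇒search : IsFinite A → (P : A → Set) → (∀ a → Dec (P a)) → Dec (Σ A P)
finite⇒search (n , A↔Fin) P P? with Fin.any? (λ k → P? (Inverse.from A↔Fin k))
... | yes (k , pk) = yes (Inverse.from A↔Fin k , pk)
... | no ∄k = no λ (a , pa) →
  ∄k (Inverse.to A↔Fin a , subst P (sym (Inverse.strictlyInverseʳ A↔Fin a)) pa)

Fin-injective⇒surjective : ∀ {n} (f : Fin n → Fin n) → Injective _≡_ _≡_ f →
                           ∀ y → Σ (Fin n) (λ x → f x ≡ y)
Fin-injective⇒surjective {zero} f f-inj ()
Fin-injective⇒surjective {suc m} f f-inj y with Fin.any? (λ x → f x Fin.≟ y)
... | yes hit = hit
... | no miss = contradiction (Fin.injective⇒≤ squeezed-injective) 1+n≰n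
  where
  -- f misses y, so punching y out of its codomain injects Fin (suc m) into Fin m.
  avoids : ∀ x → y ≢ f x
  avoids x y≡fx = miss (x , sym y≡fx)
  squeezed : Fin (suc m) → Fin m
  squeezed x = punchOut (avoids x)
  squeezed-injective : Injective _≡_ _≡_ squeezed
  squeezed-injective {x} {z} eq = f-inj (Fin.punchOut-injective (avoids x) (avoids z) eq)

injective⇒surjective : IsFinite A → (f : A → A) → Injective _≡_ _≡_ f →
                       ∀ y → Σ A (λ x → f x ≡ y)
injective⇒surjective (n , A↔Fin) f f-inj y =
  let k , eq = Fin-injective⇒surjective (Injection.to conjugate) (Injection.injective conjugate)
                                        (Inverse.to A↔Fin y)
  in Inverse.from A↔Fin k , Injection.injective (↔⇒↣ A↔Fin) eq
  where
  conjugate : Fin n ↣ Fin n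
  conjugate = ↔⇒↣ A↔Fin ↣-∘ (mk↣ f-inj ↣-∘ ↔⇒↣ (↔-sym A↔Fin))

section⇒inverse : IsFinite A → B ↣ A → (t : B → A) (s : A → B) →
                  (∀ x → t (s x) ≡ x) → ∀ y → s (t y) ≡ y
section⇒inverse A-fin B↣A t s ts y =
  let x , eq = injective⇒surjective A-fin (λ x → to (s x))
                                    (λ eq → s-injective (injective eq)) (to y)
      sx≡y = injective eq
  in trans (cong (λ z → s (t z)) (sym sx≡y)) (trans (cong s (ts x)) sx≡y)
  where
  open Injection B↣A using (to; injective)
  s-injective : Injective _≡_ _≡_ s
  s-injective {x} {x'} eq = trans (sym (ts x)) (trans (cong t eq) (ts x'))

resp-≡ : (f : Hom X Y) {a : E X} {e : E Y} → fE f a ≡ e → UEq (ends Y e) (mapPair (fV f) (ends X a))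
resp-≡ f {a} refl = resp f a

IsSurjective : Hom X Y → Set
IsSurjective {X} {Y} f = (∀ w → Σ (V X) λ p → fV f p ≡ w) × (∀ e → Σ (E X) λ a → fE f a ≡ e)

Iso-to-surjective : (X≅Y : Iso X Y) → IsSurjective (proj₁ X≅Y)
Iso-to-surjective (ψ , φ , _ , ψφ≈id) = (λ w → fV φ w , proj₁ ψφ≈id w) , (λ e → fE φ e , proj₂ ψφ≈id e)

Iso-from-surjective : (X≅Y : Iso X Y) → IsSurjective (proj₁ (proj₂ X≅Y))
Iso-from-surjective (ψ , φ , φψ≈id , _) = (λ w → fV ψ w , proj₁ φψ≈id w) , (λ e → fE ψ e , proj₂ φψ≈id e)

Iso⇒↣V : Iso X Y → V Y ↣ V X
Iso⇒↣V (ψ , φ , _ , ψφ≈id) = mk↣ λ {w} {w'} eq →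
  trans (sym (proj₁ ψφ≈id w)) (trans (cong (fV ψ) eq) (proj₁ ψφ≈id w'))

∘-surjective : (g : Hom Y Z) (f : Hom X Y) → IsSurjective g → IsSurjective f → IsSurjective (g ∘H f)
∘-surjective g f (gV , gE) (fV' , fE') =
  (λ w → let q , gq≡w = gV w ; p , fp≡q = fV' q in p , trans (cong (fV g) fp≡q) gq≡w) ,
  (λ e → let b , gb≡e = gE e ; a , fa≡b = fE' b in a , trans (cong (fE g) fa≡b) gb≡e)

surjective⇒epi : (f : Hom X Y) → IsSurjective f → Epi f
surjective⇒epi f (onV , onE) Z g h gf≈hf =
  (λ w → let p , fp≡w = onV w in subst (λ w → fV g w ≡ fV h w) fp≡w (proj₁ gf≈hf p)) ,
  (λ e → let a , fa≡e = onE e in subst (λ e → fE g e ≡ fE h e) fa≡e (proj₂ gf≈hf a))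

epi-factor : (t : Hom Y Z) (f : Hom X Y) (δ : Hom X Z) → (t ∘H f) ≈H δ → Epi δ → Epi t
epi-factor t f δ (t∘f≈δV , t∘f≈δE) δ-epi W g h gt≈ht = δ-epi W g h
  ( (λ p → subst (λ w → fV g w ≡ fV h w) (t∘f≈δV p) (proj₁ gt≈ht (fV f p)))
  , (λ a → subst (λ e → fE g e ≡ fE h e) (t∘f≈δE a) (proj₂ gt≈ht (fE f a))) )

PairGraph : Set → Graph
PairGraph A = record { V = A ; E = A × A ; ends = id }

indicator : (V Y → Bool) → Hom Y (PairGraph Bool)
indicator {Y} χ = record { fV = χ ; fE = λ e → mapPair χ (ends Y e) ; resp = λ _ → inj₁ (refl , refl) }

-- An epimorphism cannot miss a vertex w: the indicator of w and the constant
-- false map agree after composing with it.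
epi⇒¬¬surjectiveV : DecidableEquality (V Y) → (f : Hom X Y) → Epi f →
                    ∀ w → ¬ ¬ Σ (V X) (λ p → fV f p ≡ w)
epi⇒¬¬surjectiveV {Y} _≟_ f f-epi w ∄p =
  false≢true (trans (proj₁ never≈isW w) (dec-true (w ≟ w) refl))
  where
  false≢true : false ≢ true
  false≢true ()
  isW : V Y → Bool
  isW v = does (v ≟ w)
  misses : ∀ p → false ≡ isW (fV f p)
  misses p = sym (dec-false (fV f p ≟ w) λ fp≡w → ∄p (p , fp≡w))
  never≈isW : indicator (λ _ → false) ≈H indicator isW
  never≈isW = f-epi (PairGraph Bool) (indicator (λ _ → false)) (indicator isW)
    (misses , λ a → mapPair-agree-on-image {g = fV f} {h₂ = isW} misses (resp f a))

_+copyOf_ : (Y : Graph) → E Y → Graph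
Y +copyOf e = record { V = V Y ; E = E Y ⊎ ⊤ ; ends = λ { (inj₁ x) → ends Y x ; (inj₂ _) → ends Y e } }

-- Likewise an edge e is detected by the two maps into Y with a parallel copy
-- of e, one of which moves e onto its copy.
epi⇒¬¬surjectiveE : DecidableEquality (E Y) → (f : Hom X Y) → Epi f →
                    ∀ e → ¬ ¬ Σ (E X) (λ a → fE f a ≡ e)
epi⇒¬¬surjectiveE {Y} _≟_ f f-epi e ∄a =
  original≢copy (trans (proj₂ keep≈move e) (move-self (e ≟ e)))
  where
  original≢copy : inj₁ e ≢ inj₂ tt
  original≢copy ()
  move : (x : E Y) → Dec (x ≡ e) → E Y ⊎ ⊤
  move x (yes _) = inj₂ tt
  move x (no _) = inj₁ x
  move-ends : ∀ x d → UEq (ends (Y +copyOf e) (move x d)) (ends Y x)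
  move-ends x (yes refl) = inj₁ (refl , refl)
  move-ends x (no _) = inj₁ (refl , refl)
  move-self : (d : Dec (e ≡ e)) → move e d ≡ inj₂ tt
  move-self (yes _) = refl
  move-self (no e≢e) = contradiction refl e≢e
  move-other : ∀ x → x ≢ e → (d : Dec (x ≡ e)) → inj₁ x ≡ move x d
  move-other x x≢e (yes x≡e) = contradiction x≡e x≢e
  move-other x x≢e (no _) = refl
  keep moveHom : Hom Y (Y +copyOf e)
  keep = record { fV = id ; fE = inj₁ ; resp = λ _ → inj₁ (refl , refl) }
  moveHom = record { fV = id ; fE = λ x → move x (x ≟ e) ; resp = λ x → move-ends x (x ≟ e) }
  keep≈move : keep ≈H moveHom
  keep≈move = f-epi _ keep moveHom
    ((λ _ → refl) , λ a → move-other (fE f a) (λ fa≡e → ∄a (a , fa≡e)) (fE f a ≟ e))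

epi⇒surjective : IsFinite (V X) → IsFinite (E X) → DecidableEquality (V Y) → DecidableEquality (E Y) →
                 (f : Hom X Y) → Epi f → IsSurjective f
epi⇒surjective finV finE _≟V_ _≟E_ f f-epi =
  (λ w → decidable-stable (finite⇒search finV _ λ p → fV f p ≟V w)
                          (epi⇒¬¬surjectiveV _≟V_ f f-epi w)) ,
  (λ e → decidable-stable (finite⇒search finE _ λ a → fE f a ≟E e)
                          (epi⇒¬¬surjectiveE _≟E_ f f-epi e))

CoequalizesKernelPair : (f : Hom X Y) → Hom X Z → Set
CoequalizesKernelPair f δ = (δ ∘H (π₀ ∘H k)) ≈H (δ ∘H (π₁ ∘H k))
  where k = eqIncl (f ∘H π₀) (f ∘H π₁)

∘-coequalizesKernelPair : (f : Hom X Y) (φ : Hom Y Z) → CoequalizesKernelPair f (φ ∘H f)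
∘-coequalizesKernelPair f φ =
  (λ (_ , fp≡fq) → cong (fV φ) fp≡fq) , (λ (_ , fa≡fb , _) → cong (fE φ) fa≡fb)

-- Two edges with the same image under f have ends identified by f either in
-- order or crosswise; loop-freeness makes the crosswise pair an edge of X ⊗ X.
factor-through-surjection : (f : Hom X Y) → IsSurjective f → Loopless X →
                            (δ : Hom X Z) → CoequalizesKernelPair f δ → Σ (Hom Y Z) λ t → (t ∘H f) ≈H δ
factor-through-surjection {X} {Y} {Z} f (onV , onE) X-loopless δ (coeqV , coeqE) =
  t , (t∘f≈δV , t∘f≈δE)
  where
  identifiesE : ∀ a b → fE f a ≡ fE f b → fE δ a ≡ fE δ b
  identifiesE a b fa≡fb
    with UEq-trans (UEq-sym (resp f a)) (resp-≡ f (sym fa≡fb))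
  ... | inj₁ (e₁ , e₂) = coeqE (inj₁ (a , b) , fa≡fb , e₁ , e₂)
  ... | inj₂ (e₁ , e₂) = coeqE (inj₂ ((a , b) , X-loopless a , X-loopless b) , fa≡fb , e₁ , e₂)
  tV : V Y → V Z
  tV w = fV δ (proj₁ (onV w))
  tE : E Y → E Z
  tE e = fE δ (proj₁ (onE e))
  t∘f≈δV : ∀ p → tV (fV f p) ≡ fV δ p
  t∘f≈δV p = coeqV ((proj₁ (onV (fV f p)) , p) , proj₂ (onV (fV f p)))
  t∘f≈δE : ∀ a → tE (fE f a) ≡ fE δ a
  t∘f≈δE a = identifiesE _ a (proj₂ (onE (fE f a)))
  t-resp : ∀ e → UEq (ends Z (tE e)) (mapPair tV (ends Y e))
  t-resp e = UEq-trans (resp δ a) (subst (λ q → UEq q (mapPair tV (ends Y e)))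
                                         (mapPair-cong t∘f≈δV (ends X a)) (UEq-sym (UEq-map tV ends-e)))
    where
    a : E X
    a = proj₁ (onE e)
    ends-e : UEq (ends Y e) (mapPair (fV f) (ends X a))
    ends-e = resp-≡ f (proj₂ (onE e))
  t : Hom Y Z
  t = record { fV = tV ; fE = tE ; resp = t-resp }

surjective⇒iso : IsFinite (V X) → IsFinite (E X) → V Y ↣ V X → E Y ↣ E X →
                 (t : Hom Y X) → IsSurjective t → Iso X Y
surjective⇒iso {X} {Y} finV finE V↣ E↣ t (onV , onE) = s , t , (tsV , tsE) , (stV , stE)
  where
  sV : V X → V Y
  sV w = proj₁ (onV w)
  sE : E X → E Y
  sE e = proj₁ (onE e)
  tsV : ∀ w → fV t (sV w) ≡ w
  tsV w = proj₂ (onV w)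
  tsE : ∀ e → fE t (sE e) ≡ e
  tsE e = proj₂ (onE e)
  stV : ∀ u → sV (fV t u) ≡ u
  stV = section⇒inverse finV V↣ (fV t) sV tsV
  stE : ∀ h → sE (fE t h) ≡ h
  stE = section⇒inverse finE E↣ (fE t) sE tsE
  s-resp : ∀ e → UEq (ends Y (sE e)) (mapPair sV (ends X e))
  s-resp e = UEq-sym (subst (UEq (mapPair sV (ends X e))) (mapPair-cong stV (ends Y (sE e)))
                            (UEq-map sV (resp-≡ t (tsE e))))
  s : Hom X Y
  s = record { fV = sV ; fE = sE ; resp = s-resp }

other-than : DecidableEquality A → (a b : A) → a ≢ b → ∀ x → Σ A (x ≢_)
other-than _≟_ a b a≢b x with x ≟ a
... | yes refl = b , a≢b
... | no x≢a = a , x≢a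

module Deck (G H : Graph) (I : Set) (eG : I ↔ E G) (eH : I ↔ E H)
            (γ : (i : I) → Iso (G ∖ Inverse.to eG i) (H ∖ Inverse.to eH i)) where

  Gs : I → Graph
  Gs i = G ∖ Inverse.to eG i

  Γ : Hom (∐ Gs) H
  Γ = copair (λ i → incl∖ H (Inverse.to eH i) ∘H proj₁ (γ i))

  ∐Gs-loopless : Loopless G → Loopless (∐ Gs)
  ∐Gs-loopless G-loopless (i , e , _) ends≡ = G-loopless e (cong proj₂ ends≡)

  Γ-surjective : DecidableEquality (E H) → (h₀ h₁ : E H) → h₀ ≢ h₁ → IsSurjective Γ
  Γ-surjective _≟_ h₀ h₁ h₀≢h₁ =
    (λ w → let p , ψp≡w = proj₁ (Iso-to-surjective (γ i₀)) w in (i₀ , p) , ψp≡w) ,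
    (λ h → let i , h≢ = avoiding h
               a , ψa≡h = proj₂ (Iso-to-surjective (γ i)) (h , h≢)
           in (i , a) , cong proj₁ ψa≡h)
    where
    i₀ : I
    i₀ = Inverse.from eH h₀
    avoiding : ∀ h → Σ I λ i → h ≢ Inverse.to eH i
    avoiding h = let h' , h≢h' = other-than _≟_ h₀ h₁ h₀≢h₁ h
                 in Inverse.from eH h' , λ h≡ → h≢h' (trans h≡ (Inverse.strictlyInverseˡ eH h'))

mainTheorem4 :
  (G H : Graph) → IsFiniteSimple G → IsFiniteSimple H →
  AtLeast4Edges G → AtLeast4Edges H →
  (I : Set) (eG : I ↔ E G) (eH : I ↔ E H) →
  (γ : (i : I) → Iso (G ∖ Inverse.to eG i) (H ∖ Inverse.to eH i)) →
  let Gs : I → Graph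
      Gs i = G ∖ Inverse.to eG i
      Γ : Hom (∐ Gs) H
      Γ = copair (λ i → incl∖ H (Inverse.to eH i) ∘H Σ.proj₁ (γ i))
      p₀ : Hom (∐ Gs ⊗ ∐ Gs) (∐ Gs)
      p₀ = π₀
      p₁ : Hom (∐ Gs ⊗ ∐ Gs) (∐ Gs)
      p₁ = π₁
      k : Hom (EqObj (Γ ∘H p₀) (Γ ∘H p₁)) (∐ Gs ⊗ ∐ Gs)
      k = eqIncl (Γ ∘H p₀) (Γ ∘H p₁)
  in (Iso G H → Σ (Hom (∐ Gs) G) (λ δ → Epi δ × ((δ ∘H (p₀ ∘H k)) ≈H (δ ∘H (p₁ ∘H k)))))
   × (Σ (Hom (∐ Gs) G) (λ δ → Epi δ × ((δ ∘H (p₀ ∘H k)) ≈H (δ ∘H (p₁ ∘H k)))) → Iso G H)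
-- Only two distinct edges of H are used.
mainTheorem4 G H (finVG , finEG , G-loopless , _) (finVH , finEH , _) _ four↣EH I eG eH γ =
  (λ G≅H → let φ = proj₁ (proj₂ G≅H) in
     φ ∘H Γ ,
     surjective⇒epi (φ ∘H Γ) (∘-surjective φ Γ (Iso-from-surjective G≅H) Γ-surj) ,
     ∘-coequalizesKernelPair Γ φ) ,
  (λ (δ , δ-epi , δ-coeq) →
     let t , t∘Γ≈δ = factor-through-surjection Γ Γ-surj (∐Gs-loopless G-loopless) δ δ-coeq
         t-epi = epi-factor t Γ δ t∘Γ≈δ δ-epi
     in surjective⇒iso finVG finEG (Iso⇒↣V (γ (Inverse.from eH h₀))) (↔⇒↣ eG ↣-∘ ↔⇒↣ (↔-sym eH))
          t (epi⇒surjective finVH finEH (finite⇒decEq finVG) (finite⇒decEq finEG) t t-epi))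
  where
  open Deck G H I eG eH γ
  h₀ : E H
  h₀ = Injection.to four↣EH fzero
  Γ-surj : IsSurjective Γ
  Γ-surj = Γ-surjective (finite⇒decEq finEH) h₀ (Injection.to four↣EH (fsuc fzero))
             (λ h₀≡h₁ → contradiction (Injection.injective four↣EH h₀≡h₁) λ ())
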